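{- Assume the principle (EC). Then every category $\mathcal C$ has a skeleton $\mathcal S$. Moreover, there exists a full faithful functor $F:\mathcal C\to\mathcal S$ such that, for the identity embedding functor $J:\mathcal S\to\mathcal C$, one has $FJ=1_{\mathcal S}$ and $JF\cong 1_{\mathcal C}$ (natural isomorphism).
   Context: Framework: von Neumann–Bernays–Gödel class theory without Foundation and Global Choice; categories may have proper classes of objects and morphisms. (EC): for every equivalence relation $R$ (a class of ordered pairs) there is a class $C$ such that for every $x\in\mathrm{dom}[R]$ the class $\{y:\langle x,y\rangle\in R\}\cap C$ is a singleton. A skeleton of $\mathcal C$ is a full subcategory $\mathcal S$ such that every object of $\mathcal C$ is isomorphic (in $\mathcal C$) to exactly one object of $\mathcal S$. A functor is faithful (full) if it is injective (surjective) on each hom-class. -}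

module Defs where

open import Level using (Level; _⊔_; suc)
open import Data.Product using (Σ; ∃; _×_; _,_; proj₁; proj₂)
open import Function.Definitions using (Injective; Surjective)
open import Relation.Binary.Core using (Rel)
open import Relation.Binary.Structures using (IsEquivalence)
open import Relation.Binary.PropositionalEquality using (_≡_; subst₂)

-- A class in NBG is rendered as a predicate; a class of ordered pairs on A
-- as a binary relation on A.

IsSingleton : ∀ {a p} {A : Set a} → (A → Set p) → Set (a ⊔ p)
IsSingleton {A = A} X = Σ A λ y → X y × (∀ z → X z → z ≡ y)

EC : (a r : Level) → Set (suc (a ⊔ r))
EC a r = (A : Set a) (R : Rel A r) → IsEquivalence R →
         Σ (A → Set (a ⊔ r)) λ C → (x : A) → IsSingleton (λ y → R x y × C y)

-- Categories (hom-classes with strict equality, as in NBG).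
record Category (o ℓ : Level) : Set (suc (o ⊔ ℓ)) where
  infixr 9 _∘_
  field
    Obj   : Set o
    Hom   : Obj → Obj → Set ℓ
    id    : ∀ {A} → Hom A A
    _∘_   : ∀ {A B C} → Hom B C → Hom A B → Hom A C
    assoc : ∀ {A B C D} {f : Hom A B} {g : Hom B C} {h : Hom C D} →
            (h ∘ g) ∘ f ≡ h ∘ (g ∘ f)
    identityˡ : ∀ {A B} {f : Hom A B} → id ∘ f ≡ f
    identityʳ : ∀ {A B} {f : Hom A B} → f ∘ id ≡ f

module _ {o ℓ} (𝒞 : Category o ℓ) where
  open Category 𝒞

  record Iso (A B : Obj) : Set ℓ where
    field
      to   : Hom A B
      from : Hom B A
      isoˡ : from ∘ to ≡ id
      isoʳ : to ∘ from ≡ id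

  FullSub : ∀ {p} → (Obj → Set p) → Category (o ⊔ p) ℓ
  FullSub P = record
    { Obj = Σ Obj P
    ; Hom = λ A B → Hom (proj₁ A) (proj₁ B)
    ; id = id
    ; _∘_ = _∘_
    ; assoc = assoc
    ; identityˡ = identityˡ
    ; identityʳ = identityʳ
    }

  IsSkeleton : ∀ {p} → (Obj → Set p) → Set (o ⊔ ℓ ⊔ p)
  IsSkeleton P = (X : Obj) →
    Σ (Σ Obj P) λ S → Iso X (proj₁ S) ×
      (∀ (S' : Σ Obj P) → Iso X (proj₁ S') → S' ≡ S)

record Functor {o ℓ o' ℓ'} (𝒞 : Category o ℓ) (𝒟 : Category o' ℓ')
       : Set (o ⊔ ℓ ⊔ o' ⊔ ℓ') where
  private
    module C = Category 𝒞
    module D = Category 𝒟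
  field
    F₀ : C.Obj → D.Obj
    F₁ : ∀ {A B} → C.Hom A B → D.Hom (F₀ A) (F₀ B)
    identity : ∀ {A} → F₁ (C.id {A}) ≡ D.id
    homomorphism : ∀ {A B C} {f : C.Hom A B} {g : C.Hom B C} →
                   F₁ (g C.∘ f) ≡ F₁ g D.∘ F₁ f

module _ {o ℓ o' ℓ'} {𝒞 : Category o ℓ} {𝒟 : Category o' ℓ'} where
  private
    module C = Category 𝒞
    module D = Category 𝒟

  Faithful : Functor 𝒞 𝒟 → Set (o ⊔ ℓ ⊔ ℓ')
  Faithful F = ∀ {A B} → Injective _≡_ _≡_ (Functor.F₁ F {A} {B})

  Full : Functor 𝒞 𝒟 → Set (o ⊔ ℓ ⊔ ℓ')
  Full F = ∀ {A B} → Surjective _≡_ _≡_ (Functor.F₁ F {A} {B})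

  FunctorEq : Functor 𝒞 𝒟 → Functor 𝒞 𝒟 → Set (o ⊔ ℓ ⊔ o' ⊔ ℓ')
  FunctorEq F G =
    Σ (∀ X → F.F₀ X ≡ G.F₀ X) λ eq₀ →
      ∀ {A B} (f : C.Hom A B) → subst₂ D.Hom (eq₀ A) (eq₀ B) (F.F₁ f) ≡ G.F₁ f
    where module F = Functor F
          module G = Functor G

  record NatIso (F G : Functor 𝒞 𝒟) : Set (o ⊔ ℓ ⊔ ℓ') where
    private
      module F = Functor F
      module G = Functor G
    field
      η      : ∀ X → Iso 𝒟 (F.F₀ X) (G.F₀ X)
      natural : ∀ {A B} (f : C.Hom A B) →
                Iso.to (η B) D.∘ F.F₁ f ≡ G.F₁ f D.∘ Iso.to (η A)

idF : ∀ {o ℓ} {𝒞 : Category o ℓ} → Functor 𝒞 𝒞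
idF {𝒞 = 𝒞} = record
  { F₀ = λ X → X ; F₁ = λ f → f
  ; identity = Eq.refl ; homomorphism = Eq.refl }
  where import Relation.Binary.PropositionalEquality as Eq

_∘F_ : ∀ {o₁ ℓ₁ o₂ ℓ₂ o₃ ℓ₃} {𝒜 : Category o₁ ℓ₁} {ℬ : Category o₂ ℓ₂}
         {𝒞 : Category o₃ ℓ₃} → Functor ℬ 𝒞 → Functor 𝒜 ℬ → Functor 𝒜 𝒞
_∘F_ G F = record
  { F₀ = λ X → G.F₀ (F.F₀ X)
  ; F₁ = λ f → G.F₁ (F.F₁ f)
  ; identity = Eq.trans (Eq.cong G.F₁ F.identity) G.identity
  ; homomorphism = Eq.trans (Eq.cong G.F₁ F.homomorphism) G.homomorphism }
  where import Relation.Binary.PropositionalEquality as Eq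
        module F = Functor F
        module G = Functor G

Incl : ∀ {o ℓ p} (𝒞 : Category o ℓ) (P : Category.Obj 𝒞 → Set p) →
       Functor (FullSub 𝒞 P) 𝒞
Incl 𝒞 P = record
  { F₀ = proj₁ ; F₁ = λ f → f
  ; identity = Eq.refl ; homomorphism = Eq.refl }
  where import Relation.Binary.PropositionalEquality as Eq

-- (EC) applied to the isomorphism relation picks a class of representatives;
-- let r x be the representative of x and t x : x ≅ r x a witnessing iso.
-- The skeleton consists of the objects y with r y ≡ y, and F x := r x acts on
-- morphisms by conjugation with isos x ≅ r x.  For F ∘ J = 1 these isos must be
-- identities on the skeleton, which t need not be; so t x is corrected by the
-- automorphism t (r x) of r x ≡ r (r x), after which a fixed object y gets
-- (t y)⁻¹ ∘ t y = id.  Full faithfulness and J ∘ F ≅ 1 then hold because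
-- conjugation by isos is a functorial bijection on hom-sets.

module Submission where

open import Defs
open import Level using (_⊔_; Lift; lift; lower)
open import Data.Product using (Σ; _×_; _,_; proj₁; proj₂)
open import Relation.Binary.PropositionalEquality
open import Relation.Binary.Structures using (IsEquivalence)
open import Axiom.UniquenessOfIdentityProofs.WithK using (uip)

module _ {o ℓ} (𝒞 : Category o ℓ) where
  open Category 𝒞
  open Iso

  Iso-refl : ∀ {A} → Iso 𝒞 A A
  Iso-refl = record { to = id ; from = id ; isoˡ = identityˡ ; isoʳ = identityˡ }

  Iso-sym : ∀ {A B} → Iso 𝒞 A B → Iso 𝒞 B A
  Iso-sym i = record { to = from i ; from = to i ; isoˡ = isoʳ i ; isoʳ = isoˡ i }

  cancelInner : ∀ {A B C D} {f : Hom C D} {g : Hom B C} {h : Hom C B} {k : Hom A C} →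
                g ∘ h ≡ id → (f ∘ g) ∘ (h ∘ k) ≡ f ∘ k
  cancelInner {f = f} {g} {h} {k} gh≡id = begin
    (f ∘ g) ∘ (h ∘ k)  ≡⟨ assoc ⟩
    f ∘ (g ∘ (h ∘ k))  ≡⟨ cong (f ∘_) (sym assoc) ⟩
    f ∘ ((g ∘ h) ∘ k)  ≡⟨ cong (λ u → f ∘ (u ∘ k)) gh≡id ⟩
    f ∘ (id ∘ k)       ≡⟨ cong (f ∘_) identityˡ ⟩
    f ∘ k              ∎
    where open ≡-Reasoning

  Iso-trans : ∀ {A B C} → Iso 𝒞 A B → Iso 𝒞 B C → Iso 𝒞 A C
  Iso-trans i j = record
    { to = to j ∘ to i
    ; from = from i ∘ from j
    ; isoˡ = trans (cancelInner (isoˡ j)) (isoˡ i)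
    ; isoʳ = trans (cancelInner (isoʳ i)) (isoʳ j)
    }

  Iso-isEquivalence : IsEquivalence (Iso 𝒞)
  Iso-isEquivalence = record { refl = Iso-refl ; sym = Iso-sym ; trans = Iso-trans }

  to≡id⇒from≡id : ∀ {A} (i : Iso 𝒞 A A) → to i ≡ id → from i ≡ id
  to≡id⇒from≡id i to≡id = begin
    from i         ≡⟨ sym identityʳ ⟩
    from i ∘ id    ≡⟨ cong (from i ∘_) (sym to≡id) ⟩
    from i ∘ to i  ≡⟨ isoˡ i ⟩
    id             ∎
    where open ≡-Reasoning

  subst-Iso-trans-sym≡id : ∀ {W Y} (e : W ≡ Y) (a : Iso 𝒞 Y W) (u : Iso 𝒞 W W) →
    subst (λ Z → Iso 𝒞 Z Z) e u ≡ subst (Iso 𝒞 Y) e a →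
    to (subst (Iso 𝒞 Y) e (Iso-trans a (Iso-sym u))) ≡ id
  subst-Iso-trans-sym≡id refl a u u≡a = trans (cong (λ v → from v ∘ to a) u≡a) (isoˡ a)

  conjugate : ∀ {A A' B B'} → Iso 𝒞 A A' → Iso 𝒞 B B' → Hom A B → Hom A' B'
  conjugate i j f = to j ∘ (f ∘ from i)

  conjugate-id : ∀ {A A'} (i : Iso 𝒞 A A') → conjugate i i id ≡ id
  conjugate-id i = trans (cong (to i ∘_) identityˡ) (isoʳ i)

  conjugate-∘ : ∀ {A A' B B' C C'} (i : Iso 𝒞 A A') (j : Iso 𝒞 B B') (k : Iso 𝒞 C C')
                {f : Hom A B} {g : Hom B C} →
                conjugate i k (g ∘ f) ≡ conjugate j k g ∘ conjugate i j f
  conjugate-∘ i j k {f} {g} = sym (begin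
    (to k ∘ (g ∘ from j)) ∘ (to j ∘ (f ∘ from i))  ≡⟨ cong (_∘ conjugate i j f) (sym assoc) ⟩
    ((to k ∘ g) ∘ from j) ∘ (to j ∘ (f ∘ from i))  ≡⟨ cancelInner (isoˡ j) ⟩
    (to k ∘ g) ∘ (f ∘ from i)                      ≡⟨ assoc ⟩
    to k ∘ (g ∘ (f ∘ from i))                      ≡⟨ cong (to k ∘_) (sym assoc) ⟩
    to k ∘ ((g ∘ f) ∘ from i)                      ∎)
    where open ≡-Reasoning

  conjugate-natural : ∀ {A A' B B'} (i : Iso 𝒞 A A') (j : Iso 𝒞 B B') (f : Hom A B) →
                      from j ∘ conjugate i j f ≡ f ∘ from i
  conjugate-natural i j f = begin
    from j ∘ (to j ∘ (f ∘ from i))  ≡⟨ sym assoc ⟩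
    (from j ∘ to j) ∘ (f ∘ from i)  ≡⟨ cong (_∘ (f ∘ from i)) (isoˡ j) ⟩
    id ∘ (f ∘ from i)               ≡⟨ identityˡ ⟩
    f ∘ from i                      ∎
    where open ≡-Reasoning

  conjugate-inverse : ∀ {A A' B B'} (i : Iso 𝒞 A A') (j : Iso 𝒞 B B') (f : Hom A B) →
                      conjugate (Iso-sym i) (Iso-sym j) (conjugate i j f) ≡ f
  conjugate-inverse i j f = begin
    from j ∘ (conjugate i j f ∘ to i)  ≡⟨ sym assoc ⟩
    (from j ∘ conjugate i j f) ∘ to i  ≡⟨ cong (_∘ to i) (conjugate-natural i j f) ⟩
    (f ∘ from i) ∘ to i                ≡⟨ assoc ⟩
    f ∘ (from i ∘ to i)                ≡⟨ cong (f ∘_) (isoˡ i) ⟩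
    f ∘ id                             ≡⟨ identityʳ ⟩
    f                                  ∎
    where open ≡-Reasoning

  conjugate-subst : ∀ {A A' A'' B B' B''} (e₁ : A' ≡ A'') (e₂ : B' ≡ B'')
                    (i : Iso 𝒞 A A') (j : Iso 𝒞 B B') (f : Hom A B) →
                    subst₂ Hom e₁ e₂ (conjugate i j f) ≡
                    conjugate (subst (Iso 𝒞 A) e₁ i) (subst (Iso 𝒞 B) e₂ j) f
  conjugate-subst refl refl i j f = refl

  conjugate-by-identities : ∀ {A B} (i : Iso 𝒞 A A) (j : Iso 𝒞 B B) (f : Hom A B) →
                            to i ≡ id → to j ≡ id → conjugate i j f ≡ f
  conjugate-by-identities i j f toi≡id toj≡id = begin
    to j ∘ (f ∘ from i)  ≡⟨ cong₂ (λ u v → u ∘ (f ∘ v)) toj≡id (to≡id⇒from≡id i toi≡id) ⟩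
    id ∘ (f ∘ id)        ≡⟨ trans identityˡ identityʳ ⟩
    f                    ∎
    where open ≡-Reasoning

subst₂-on-proj₁ : ∀ {a b c} {A : Set a} {P : A → Set b} (H : A → A → Set c)
                  {S S' T T' : Σ A P} (e₁ : S ≡ S') (e₂ : T ≡ T') (h : H (proj₁ S) (proj₁ T)) →
                  subst₂ (λ S T → H (proj₁ S) (proj₁ T)) e₁ e₂ h ≡
                  subst₂ H (cong proj₁ e₁) (cong proj₁ e₂) h
subst₂-on-proj₁ H refl refl h = refl

module Representatives {o ℓ} (ec : EC o ℓ) (𝒞 : Category o ℓ) where
  open Category 𝒞
  open Iso

  private
    Chosen : Obj → Set (o ⊔ ℓ)
    Chosen = proj₁ (ec Obj (Iso 𝒞) (Iso-isEquivalence 𝒞))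

    chosenIsoClass : ∀ x → Σ Obj λ y → (Iso 𝒞 x y × Chosen y) × (∀ z → Iso 𝒞 x z × Chosen z → z ≡ y)
    chosenIsoClass = proj₂ (ec Obj (Iso 𝒞) (Iso-isEquivalence 𝒞))

  rep : Obj → Obj
  rep x = proj₁ (chosenIsoClass x)

  rep-iso : ∀ x → Iso 𝒞 x (rep x)
  rep-iso x = proj₁ (proj₁ (proj₂ (chosenIsoClass x)))

  rep-chosen : ∀ x → Chosen (rep x)
  rep-chosen x = proj₂ (proj₁ (proj₂ (chosenIsoClass x)))

  rep-resp-Iso : ∀ {x z} → Iso 𝒞 x z → rep z ≡ rep x
  rep-resp-Iso {x} {z} i =
    proj₂ (proj₂ (chosenIsoClass x)) (rep z) (Iso-trans 𝒞 i (rep-iso z) , rep-chosen z)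

  rep-idempotent : ∀ x → rep (rep x) ≡ rep x
  rep-idempotent x = rep-resp-Iso (rep-iso x)

  rep-loop : ∀ x → Iso 𝒞 (rep x) (rep x)
  rep-loop x = subst (Iso 𝒞 (rep x)) (rep-idempotent x) (rep-iso (rep x))

  toRep : ∀ x → Iso 𝒞 x (rep x)
  toRep x = Iso-trans 𝒞 (rep-iso x) (Iso-sym 𝒞 (rep-loop x))

  rep-loop-fixed : ∀ {y} (e : rep y ≡ y) →
                   subst (λ z → Iso 𝒞 z z) e (rep-loop y) ≡ subst (Iso 𝒞 y) e (rep-iso y)
  rep-loop-fixed e = transported e (rep-idempotent _) e
    where
      transported : ∀ {W y} (e : W ≡ y) (p : rep W ≡ W) (q : rep y ≡ y) →
                    subst (λ z → Iso 𝒞 z z) e (subst (Iso 𝒞 W) p (rep-iso W)) ≡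
                    subst (Iso 𝒞 y) q (rep-iso y)
      transported refl p q = cong (λ r → subst (Iso 𝒞 _) r (rep-iso _)) (uip p q)

  toRep-fixed : ∀ {y} (e : rep y ≡ y) → to (subst (Iso 𝒞 y) e (toRep y)) ≡ id
  toRep-fixed {y} e = subst-Iso-trans-sym≡id 𝒞 e (rep-iso y) (rep-loop y) (rep-loop-fixed e)

  Fixed : Obj → Set (o ⊔ ℓ)
  Fixed y = Lift ℓ (rep y ≡ y)

  Fixed-≡ : ∀ {a b} → a ≡ b → {p : Fixed a} {q : Fixed b} → _≡_ {A = Σ Obj Fixed} (a , p) (b , q)
  Fixed-≡ refl {lift p} {lift q} = cong (λ r → _ , lift r) (uip p q)

  Fixed-isSkeleton : IsSkeleton 𝒞 Fixed
  Fixed-isSkeleton X = (rep X , lift (rep-idempotent X)) , toRep X ,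
    λ { (z , lift q) i → Fixed-≡ (trans (sym q) (rep-resp-Iso i)) }

  reflect : Functor 𝒞 (FullSub 𝒞 Fixed)
  reflect = record
    { F₀ = λ X → rep X , lift (rep-idempotent X)
    ; F₁ = λ {A} {B} → conjugate 𝒞 (toRep A) (toRep B)
    ; identity = λ {A} → conjugate-id 𝒞 (toRep A)
    ; homomorphism = λ {A} {B} {C} → conjugate-∘ 𝒞 (toRep A) (toRep B) (toRep C)
    }

  reflect-full : Full reflect
  reflect-full {A} {B} h =
    conjugate 𝒞 (Iso-sym 𝒞 (toRep A)) (Iso-sym 𝒞 (toRep B)) h ,
    λ e → trans (cong (conjugate 𝒞 (toRep A) (toRep B)) e)
                (conjugate-inverse 𝒞 (Iso-sym 𝒞 (toRep A)) (Iso-sym 𝒞 (toRep B)) h)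

  reflect-faithful : Faithful reflect
  reflect-faithful {A} {B} {f} {g} e = begin
    f                                   ≡⟨ sym (conjugate-inverse 𝒞 (toRep A) (toRep B) f) ⟩
    conjugate⁻¹ (Functor.F₁ reflect f)  ≡⟨ cong conjugate⁻¹ e ⟩
    conjugate⁻¹ (Functor.F₁ reflect g)  ≡⟨ conjugate-inverse 𝒞 (toRep A) (toRep B) g ⟩
    g                                   ∎
    where
      open ≡-Reasoning
      conjugate⁻¹ : Hom (rep A) (rep B) → Hom A B
      conjugate⁻¹ = conjugate 𝒞 (Iso-sym 𝒞 (toRep A)) (Iso-sym 𝒞 (toRep B))

  reflect∘incl≡id : FunctorEq (reflect ∘F Incl 𝒞 Fixed) idF
  reflect∘incl≡id = reflect-fixed , λ {A} {B} f → begin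
    subst₂ (λ S T → Hom (proj₁ S) (proj₁ T)) (reflect-fixed A) (reflect-fixed B) (F₁ f)
      ≡⟨ subst₂-on-proj₁ Hom (reflect-fixed A) (reflect-fixed B) (F₁ f) ⟩
    subst₂ Hom (cong proj₁ (reflect-fixed A)) (cong proj₁ (reflect-fixed B)) (F₁ f)
      ≡⟨ cong₂ (λ p q → subst₂ Hom p q (F₁ f)) (uip _ (lower (proj₂ A))) (uip _ (lower (proj₂ B))) ⟩
    subst₂ Hom (lower (proj₂ A)) (lower (proj₂ B)) (F₁ f)
      ≡⟨ conjugate-subst 𝒞 (lower (proj₂ A)) (lower (proj₂ B)) (toRep _) (toRep _) f ⟩
    conjugate 𝒞 (fixedToRep A) (fixedToRep B) f
      ≡⟨ conjugate-by-identities 𝒞 (fixedToRep A) (fixedToRep B) f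
                                 (toRep-fixed (lower (proj₂ A))) (toRep-fixed (lower (proj₂ B))) ⟩
    f ∎
    where
      open ≡-Reasoning
      open Functor reflect using (F₁)
      reflect-fixed : ∀ (S : Σ Obj Fixed) → Functor.F₀ reflect (proj₁ S) ≡ S
      reflect-fixed (y , lift q) = Fixed-≡ q
      fixedToRep : ∀ (S : Σ Obj Fixed) → Iso 𝒞 (proj₁ S) (proj₁ S)
      fixedToRep (y , lift q) = subst (Iso 𝒞 y) q (toRep y)

  incl∘reflect≅id : NatIso (Incl 𝒞 Fixed ∘F reflect) idF
  incl∘reflect≅id = record
    { η = λ X → Iso-sym 𝒞 (toRep X)
    ; natural = λ {A} {B} → conjugate-natural 𝒞 (toRep A) (toRep B)
    }

mainTheorem9 : ∀ {o ℓ} → EC o ℓ → (𝒞 : Category o ℓ) →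
    Σ (Category.Obj 𝒞 → Set (o ⊔ ℓ)) λ P →
      IsSkeleton 𝒞 P ×
      Σ (Functor 𝒞 (FullSub 𝒞 P)) λ F →
        Full F × Faithful F ×
        FunctorEq (F ∘F Incl 𝒞 P) idF ×
        NatIso (Incl 𝒞 P ∘F F) idF
mainTheorem9 ec 𝒞 =
  Fixed , Fixed-isSkeleton ,
  reflect , reflect-full , reflect-faithful , reflect∘incl≡id , incl∘reflect≅id
  where open Representatives ec 𝒞
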